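{- Let $G$ be an ordered graph and $A \subset V(G)$. Then $|\partial_{[A]}G| \geqslant \dfrac{|A| - m(G)}{2}$, where $\partial_{[A]}G = \{G - a : a \in A\}$.
   Context: An ordered graph is a graph with a linear order on its vertices, identified with one on $[n]$ with the usual order; $G - v$ is the induced ordered subgraph on $V(G)\setminus\{v\}$, and ordered graphs are compared via the order-preserving identification. For $x,y \in V(G)$ write $x \sim y$ if $\Gamma(x)\setminus\{y\} = \Gamma(y)\setminus\{x\}$. A homogeneous block is a maximal set of consecutive vertices any two of which satisfy $x\sim y$. The excess of $G$ is $m(G) = \sum_{B \text{ homogeneous block}, |B|\geqslant 3}(|B|-2)$. -}

module Defs where

open import Data.Bool using (Bool; true; false; _∧_; _∨_; not; if_then_else_)
open import Data.Bool.Properties using () renaming (_≟_ to _≟ᵇ_)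
open import Data.Nat using (ℕ; zero; suc; pred; _+_; _∸_; _≤ᵇ_; _≡ᵇ_)
open import Data.Fin using (Fin; toℕ; _≟_)
open import Data.Fin.Subset using (Subset)
open import Data.Fin.Subset.Properties using (_∈?_)
open import Data.Vec using (Vec; lookup; removeAt; map)
import Data.Vec.Properties as VecP
open import Data.Bool.ListAction using (all)
open import Data.Nat.ListAction using (sum)
open import Data.List using (List; []; _∷_; length; filter; deduplicate; allFin; concatMap)
import Data.List as L
open import Data.Product using (_×_; _,_)
open import Relation.Nullary.Decidable using (⌊_⌋)
open import Relation.Binary.PropositionalEquality using (_≡_; _≢_)
open import Relation.Binary.Definitions using (DecidableEquality)

-- An ordered graph on the vertex set [n] (= Fin n with its usual order),
-- given by its adjacency matrix.
Mat : ℕ → Set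
Mat n = Vec (Vec Bool n) n

adj : ∀ {n} → Mat n → Fin n → Fin n → Bool
adj G x y = lookup (lookup G x) y

IsGraph : ∀ {n} → Mat n → Set
IsGraph {n} G = (∀ (x y : Fin n) → adj G x y ≡ adj G y x) × (∀ (x : Fin n) → adj G x x ≡ false)

-- G - v : the induced ordered subgraph on V(G) \ {v}, with the
-- order-preserving identification of the remaining vertices with [n-1].
delete : ∀ {n} → Mat n → Fin n → Mat (pred n)
delete {suc n} G v = map (λ row → removeAt row v) (removeAt G v)

Mat-≟ : ∀ {n} → DecidableEquality (Mat n)
Mat-≟ = VecP.≡-dec (VecP.≡-dec _≟ᵇ_)

_==_ : ∀ {n} → Fin n → Fin n → Bool
x == y = ⌊ x ≟ y ⌋

-- x ∼ y  iff  Γ(x) \ {y} = Γ(y) \ {x}  (compared pointwise over all vertices z)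
twin : ∀ {n} → Mat n → Fin n → Fin n → Bool
twin {n} G x y =
  all (λ z → ⌊ (adj G x z ∧ not (z == y)) ≟ᵇ (adj G y z ∧ not (z == x)) ⌋) (allFin n)

inI : ∀ {n} → Fin n → Fin n → Fin n → Bool
inI i j x = (toℕ i ≤ᵇ toℕ x) ∧ (toℕ x ≤ᵇ toℕ j)

homog : ∀ {n} → Mat n → Fin n → Fin n → Bool
homog {n} G i j =
  all (λ x → all (λ y → not (inI i j x ∧ inI i j y) ∨ twin G x y) (allFin n)) (allFin n)

isBlock : ∀ {n} → Mat n → Fin n → Fin n → Bool
isBlock {n} G i j =
  (toℕ i ≤ᵇ toℕ j) ∧ homog G i j ∧
  all (λ i' → all (λ j' →
        not ((toℕ i' ≤ᵇ toℕ i) ∧ (toℕ j ≤ᵇ toℕ j') ∧ homog G i' j')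
        ∨ ((i' == i) ∧ (j' == j))) (allFin n)) (allFin n)

-- m(G) = Σ_{B block, |B| ≥ 3} (|B| - 2); blocks with |B| ≤ 2 contribute
-- (|B| ∸ 2) = 0, so summing (|B| ∸ 2) over all blocks is the same sum.
excess : ∀ {n} → Mat n → ℕ
excess {n} G =
  sum (concatMap (λ i → L.map (λ j →
        if isBlock G i j then (suc (toℕ j) ∸ toℕ i) ∸ 2 else 0) (allFin n)) (allFin n))

elems : ∀ {n} → Subset n → List (Fin n)
elems {n} A = filter (λ a → a ∈? A) (allFin n)

boundary : ∀ {n} → Mat n → Subset n → List (Mat (pred n))
boundary G A = deduplicate Mat-≟ (L.map (delete G) (elems A))

module Submission where

-- Let xs be the elements of A in increasing order and consider the list of
-- deletions G - x, x ∈ xs.  A count valid for any list (Multiplicities)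
-- gives  |xs| ≤ 2 · #distinct + repeats,  where repeats counts the positions
-- x whose deletion G - x occurs at least twice more later in the list.  For
-- such an x there are x < b < c with G - x = G - b = G - c; comparing these
-- ordered graphs vertex by vertex (Deletions, phrased for an adjacency
-- function on ℕ) shows that the interval [x, c] is homogeneous, so it lies
-- in a homogeneous block [i, j] with i ≤ x ≤ j − 2 (OrderedGraph).  Hence
-- repeats is at most the number of pairs (x, B) of a vertex x and a block B
-- containing x and two later vertices, and a block B takes part in at most
-- |B| − 2 such pairs, which sums to m(G) (Bound).

open import Defs
open import Data.Bool using (Bool; true; false; _∧_; _∨_; not; T; if_then_else_)
open import Data.Bool.Properties using (∧-zeroʳ; ∧-identityʳ) renaming (_≟_ to _≟ᵇ_)
open import Data.Bool.ListAction using (all)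
open import Data.Empty using (⊥-elim)
open import Data.Unit using (tt)
open import Data.Nat using (ℕ; zero; suc; _+_; _*_; _∸_; _≤_; _<_; z≤n; s≤s; _≤?_; _<?_; _≤ᵇ_)
open import Data.Nat.Properties hiding (_≟_)
open import Data.Nat.Tactic.RingSolver using (solve-∀)
open import Data.Nat.ListAction using (sum)
open import Data.Nat.ListAction.Properties using (sum-++)
open import Data.Fin as F using (Fin; toℕ; fromℕ<; punchIn; punchOut; _≟_)
open import Data.Fin.Properties
  using (toℕ-injective; toℕ<n; fromℕ<-toℕ; toℕ-fromℕ<; punchOut-punchIn; punchInᵢ≢i)
open import Data.Fin.Subset using (Subset; ∣_∣; inside; outside)
open import Data.Fin.Subset.Properties using (_∈?_)
open import Data.Vec as V using (Vec; lookup; removeAt; _∷_; [])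
open import Data.Vec.Properties using (lookup-map; removeAt-punchOut)
open import Data.List
  using (List; []; _∷_; length; filter; deduplicate; map; allFin; tabulate; concat; concatMap)
open import Data.List.Properties
  using (filter-idem; filter-accept; filter-reject; length-filter; length-map; map-tabulate; map-∘; map-cong)
open import Data.List.Membership.Propositional using (_∈_)
open import Data.List.Membership.Propositional.Properties using (∈-allFin)
open import Data.List.Relation.Unary.Any using (here; there)
open import Data.List.Relation.Unary.All using (All; _∷_) renaming (lookup to All-lookup)
open import Data.List.Relation.Unary.AllPairs using (AllPairs; []; _∷_)
import Data.List.Relation.Unary.AllPairs.Properties as AllPairs
open import Data.Product using (Σ; _×_; _,_; proj₁; proj₂)
open import Data.Sum as Sum using (_⊎_; inj₁; inj₂)
open import Function using (_∘_; id)
open import Level using (0ℓ)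
open import Relation.Binary.Core using (Rel)
open import Relation.Binary.Definitions using (DecidableEquality; tri<; tri≈; tri>)
open import Relation.Binary.PropositionalEquality
open import Relation.Nullary using (¬_; Dec; yes; no; ¬?; does)
open import Relation.Nullary.Decidable using (dec-true; isYes≗does)
open import Relation.Unary using (Pred; Decidable)

filter-comm : ∀ {X : Set} {P Q : Pred X 0ℓ} (P? : Decidable P) (Q? : Decidable Q) xs →
  filter P? (filter Q? xs) ≡ filter Q? (filter P? xs)
filter-comm P? Q? [] = refl
filter-comm {P = P} {Q} P? Q? (x ∷ xs) = byCases (P? x) (Q? x)
  where
  open ≡-Reasoning
  ih = filter-comm P? Q? xs
  byCases : Dec (P x) → Dec (Q x) → filter P? (filter Q? (x ∷ xs)) ≡ filter Q? (filter P? (x ∷ xs))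
  byCases (yes p) (yes q) = begin
    filter P? (filter Q? (x ∷ xs)) ≡⟨ cong (filter P?) (filter-accept Q? q) ⟩
    filter P? (x ∷ filter Q? xs)   ≡⟨ filter-accept P? p ⟩
    x ∷ filter P? (filter Q? xs)   ≡⟨ cong (x ∷_) ih ⟩
    x ∷ filter Q? (filter P? xs)   ≡⟨ filter-accept Q? q ⟨
    filter Q? (x ∷ filter P? xs)   ≡⟨ cong (filter Q?) (filter-accept P? p) ⟨
    filter Q? (filter P? (x ∷ xs)) ∎
  byCases (yes p) (no ¬q) = begin
    filter P? (filter Q? (x ∷ xs)) ≡⟨ cong (filter P?) (filter-reject Q? ¬q) ⟩
    filter P? (filter Q? xs)       ≡⟨ ih ⟩
    filter Q? (filter P? xs)       ≡⟨ filter-reject Q? ¬q ⟨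
    filter Q? (x ∷ filter P? xs)   ≡⟨ cong (filter Q?) (filter-accept P? p) ⟨
    filter Q? (filter P? (x ∷ xs)) ∎
  byCases (no ¬p) (yes q) = begin
    filter P? (filter Q? (x ∷ xs)) ≡⟨ cong (filter P?) (filter-accept Q? q) ⟩
    filter P? (x ∷ filter Q? xs)   ≡⟨ filter-reject P? ¬p ⟩
    filter P? (filter Q? xs)       ≡⟨ ih ⟩
    filter Q? (filter P? xs)       ≡⟨ cong (filter Q?) (filter-reject P? ¬p) ⟨
    filter Q? (filter P? (x ∷ xs)) ∎
  byCases (no ¬p) (no ¬q) = begin
    filter P? (filter Q? (x ∷ xs)) ≡⟨ cong (filter P?) (filter-reject Q? ¬q) ⟩
    filter P? (filter Q? xs)       ≡⟨ ih ⟩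
    filter Q? (filter P? xs)       ≡⟨ cong (filter Q?) (filter-reject P? ¬p) ⟨
    filter Q? (filter P? (x ∷ xs)) ∎

atLeastTwo : ℕ → ℕ
atLeastTwo (suc (suc _)) = 1
atLeastTwo _ = 0

-- Arithmetic behind the count below: a value with 1 + o copies is paid for
-- by two units, the indicator of its first position and the o ∸ 2 surplus.
suc≤2+atLeastTwo+surplus : ∀ o → suc o ≤ 2 + (atLeastTwo o + (o ∸ 2))
suc≤2+atLeastTwo+surplus zero = s≤s z≤n
suc≤2+atLeastTwo+surplus (suc zero) = ≤-refl
suc≤2+atLeastTwo+surplus (suc (suc o)) = ≤-refl

surplus-suc : ∀ o → suc o ∸ 2 ≤ atLeastTwo o + (o ∸ 2)
surplus-suc zero = z≤n
surplus-suc (suc zero) = z≤n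
surplus-suc (suc (suc o)) = ≤-refl

-- The key fact is length ys ≤ 2 · distinct ys + repeats ys: every value
-- accounts for two of its copies, and each further copy is charged to a
-- position that is followed by at least two more copies of its value.
module Multiplicities {X : Set} (_≟X_ : DecidableEquality X) where

  occurrences : X → List X → ℕ
  occurrences y [] = 0
  occurrences y (z ∷ zs) with y ≟X z
  ... | yes _ = suc (occurrences y zs)
  ... | no _ = occurrences y zs

  without : X → List X → List X
  without y = filter (¬? ∘ (y ≟X_))

  distinct : List X → ℕ
  distinct ys = length (deduplicate _≟X_ ys)

  repeats : List X → ℕ
  repeats [] = 0
  repeats (y ∷ ys) = atLeastTwo (occurrences y ys) + repeats ys

  occurrences+without : ∀ y zs → occurrences y zs + length (without y zs) ≡ length zs
  occurrences+without y [] = refl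
  occurrences+without y (z ∷ zs) with y ≟X z
  ... | yes _ = cong suc (occurrences+without y zs)
  ... | no _ = trans (+-suc (occurrences y zs) _) (cong suc (occurrences+without y zs))

  occurrences-without : ∀ {y z} → ¬ y ≡ z → ∀ zs → occurrences z (without y zs) ≡ occurrences z zs
  occurrences-without y≢z [] = refl
  occurrences-without {y} {z} y≢z (w ∷ ws) with y ≟X w
  ... | yes refl with z ≟X y
  ...   | yes z≡y = ⊥-elim (y≢z (sym z≡y))
  ...   | no _ = occurrences-without y≢z ws
  occurrences-without {y} {z} y≢z (w ∷ ws) | no _ with z ≟X w
  ...   | yes _ = cong suc (occurrences-without y≢z ws)
  ...   | no _ = occurrences-without y≢z ws

  -- removing y from zs loses at least occurrences y zs ∸ 2 repeat
  -- positions: all copies of y except the last two are such positions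
  repeats-without : ∀ y zs → repeats (without y zs) + (occurrences y zs ∸ 2) ≤ repeats zs
  repeats-without y [] = z≤n
  repeats-without y (z ∷ zs) with y ≟X z
  ... | yes refl = begin
      repeats (without y zs) + (suc o ∸ 2)
        ≤⟨ +-monoʳ-≤ (repeats (without y zs)) (surplus-suc o) ⟩
      repeats (without y zs) + (atLeastTwo o + (o ∸ 2))
        ≡⟨ +-comm-middle (repeats (without y zs)) (atLeastTwo o) (o ∸ 2) ⟩
      atLeastTwo o + (repeats (without y zs) + (o ∸ 2))
        ≤⟨ +-monoʳ-≤ (atLeastTwo o) (repeats-without y zs) ⟩
      atLeastTwo o + repeats zs ∎
    where open ≤-Reasoning
          o = occurrences y zs
          +-comm-middle : ∀ a b c → a + (b + c) ≡ b + (a + c)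
          +-comm-middle = solve-∀
  ... | no y≢z = begin
      atLeastTwo (occurrences z (without y zs)) + repeats (without y zs) + (occurrences y zs ∸ 2)
        ≡⟨ +-assoc (atLeastTwo (occurrences z (without y zs))) _ _ ⟩
      atLeastTwo (occurrences z (without y zs)) + (repeats (without y zs) + (occurrences y zs ∸ 2))
        ≡⟨ cong (λ o → atLeastTwo o + _) (occurrences-without y≢z zs) ⟩
      atLeastTwo (occurrences z zs) + (repeats (without y zs) + (occurrences y zs ∸ 2))
        ≤⟨ +-monoʳ-≤ (atLeastTwo (occurrences z zs)) (repeats-without y zs) ⟩
      atLeastTwo (occurrences z zs) + repeats zs ∎
    where open ≤-Reasoning

  without-deduplicate : ∀ y xs → without y (deduplicate _≟X_ xs) ≡ deduplicate _≟X_ (without y xs)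
  without-deduplicate y [] = refl
  without-deduplicate y (x ∷ xs) with y ≟X x
  ... | yes refl = trans (filter-idem (¬? ∘ (y ≟X_)) (deduplicate _≟X_ xs)) (without-deduplicate y xs)
  ... | no _ = cong (x ∷_) (trans (filter-comm (¬? ∘ (y ≟X_)) (¬? ∘ (x ≟X_)) (deduplicate _≟X_ xs))
                                  (cong (without x) (without-deduplicate y xs)))

  -- length ys ≤ 2 · distinct ys + repeats ys, by strong induction on the
  -- length: split off all copies of the head y, of which there are 1 + o.
  length≤2*distinct+repeats : ∀ ys → length ys ≤ 2 * distinct ys + repeats ys
  length≤2*distinct+repeats ys = bounded (length ys) ys ≤-refl
    where
    bounded : ∀ k ys → length ys ≤ k → length ys ≤ 2 * distinct ys + repeats ys
    bounded k [] _ = z≤n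
    bounded (suc k) (y ∷ rest) (s≤s |rest|≤k) = begin
        suc (length rest)                  ≡⟨ cong suc (occurrences+without y rest) ⟨
        suc (o + length rest')             ≤⟨ +-monoˡ-≤ (length rest') (suc≤2+atLeastTwo+surplus o) ⟩
        2 + (atLeastTwo o + (o ∸ 2)) + length rest'
          ≤⟨ +-monoʳ-≤ (2 + (atLeastTwo o + (o ∸ 2))) ih ⟩
        2 + (atLeastTwo o + (o ∸ 2)) + (2 * d' + repeats rest')
          ≡⟨ regroup (atLeastTwo o) (o ∸ 2) d' (repeats rest') ⟩
        2 * suc d' + (atLeastTwo o + (repeats rest' + (o ∸ 2)))
          ≤⟨ +-monoʳ-≤ (2 * suc d') (+-monoʳ-≤ (atLeastTwo o) (repeats-without y rest)) ⟩
        2 * suc d' + (atLeastTwo o + repeats rest)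
          ≡⟨ cong (λ d → 2 * suc d + (atLeastTwo o + repeats rest)) (cong length (without-deduplicate y rest)) ⟨
        2 * distinct (y ∷ rest) + repeats (y ∷ rest) ∎
      where
      open ≤-Reasoning
      o = occurrences y rest
      rest' = without y rest
      d' = distinct rest'
      ih : length rest' ≤ 2 * d' + repeats rest'
      ih = bounded k rest' (≤-trans (length-filter (¬? ∘ (y ≟X_)) rest) |rest|≤k)
      regroup : ∀ a b d r → 2 + (a + b) + (2 * d + r) ≡ 2 * suc d + (a + (r + b))
      regroup = solve-∀

  occurs-in-map : ∀ {Z : Set} (f : Z → X) y zs → 1 ≤ occurrences y (map f zs) →
    Σ Z λ c → c ∈ zs × y ≡ f c
  occurs-in-map f y (z ∷ zs) o with y ≟X f z
  ... | yes y≡fz = z , here refl , y≡fz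
  ... | no _ = let (c , c∈zs , y≡fc) = occurs-in-map f y zs o in c , there c∈zs , y≡fc

  occurs-twice-in-map : ∀ {Z : Set} {R : Rel Z 0ℓ} (f : Z → X) y zs → AllPairs R zs →
    2 ≤ occurrences y (map f zs) →
    Σ Z λ b → Σ Z λ c → b ∈ zs × c ∈ zs × R b c × y ≡ f b × y ≡ f c
  occurs-twice-in-map f y (z ∷ zs) (z<zs ∷ sorted) o with y ≟X f z
  ... | yes y≡fz = let (c , c∈zs , y≡fc) = occurs-in-map f y zs (≤-pred o)
                   in z , c , here refl , there c∈zs , All-lookup z<zs c∈zs , y≡fz , y≡fc
  ... | no _ = let (b , c , b∈ , c∈ , bRc , y≡fb , y≡fc) = occurs-twice-in-map f y zs sorted o
               in b , c , there b∈ , there c∈ , bRc , y≡fb , y≡fc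

sum-mono : ∀ {X : Set} (f g : X → ℕ) xs → (∀ x → f x ≤ g x) → sum (map f xs) ≤ sum (map g xs)
sum-mono f g [] _ = z≤n
sum-mono f g (x ∷ xs) f≤g = +-mono-≤ (f≤g x) (sum-mono f g xs f≤g)

sum-zero : ∀ {X : Set} (xs : List X) → sum (map (λ _ → 0) xs) ≡ 0
sum-zero [] = refl
sum-zero (x ∷ xs) = sum-zero xs

sum-+ : ∀ {X : Set} (f g : X → ℕ) xs →
  sum (map (λ x → f x + g x) xs) ≡ sum (map f xs) + sum (map g xs)
sum-+ f g [] = refl
sum-+ f g (x ∷ xs) = trans (cong (f x + g x +_) (sum-+ f g xs)) (regroup (f x) (g x) _ _)
  where regroup : ∀ a b c d → a + b + (c + d) ≡ a + c + (b + d)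
        regroup = solve-∀

sum-swap : ∀ {X Y : Set} (h : X → Y → ℕ) xs ys →
  sum (map (λ x → sum (map (h x) ys)) xs) ≡ sum (map (λ y → sum (map (λ x → h x y) xs)) ys)
sum-swap h [] ys = sym (sum-zero ys)
sum-swap h (x ∷ xs) ys =
  trans (cong (sum (map (h x) ys) +_) (sum-swap h xs ys))
        (sym (sum-+ (h x) (λ y → sum (map (λ x → h x y) xs)) ys))

sum-filter : ∀ {X : Set} {P : Pred X 0ℓ} (P? : Decidable P) (f : X → ℕ) xs →
  sum (map f (filter P? xs)) ≤ sum (map f xs)
sum-filter P? f [] = z≤n
sum-filter P? f (x ∷ xs) with does (P? x)
... | true = +-monoʳ-≤ (f x) (sum-filter P? f xs)
... | false = ≤-trans (sum-filter P? f xs) (m≤n+m _ (f x))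

term≤sum : ∀ {X : Set} (f : X → ℕ) {x} xs → x ∈ xs → f x ≤ sum (map f xs)
term≤sum f (y ∷ ys) (here refl) = m≤m+n _ _
term≤sum f (y ∷ ys) (there x∈ys) = ≤-trans (term≤sum f ys x∈ys) (m≤n+m _ (f y))

sum-concat : ∀ (xss : List (List ℕ)) → sum (concat xss) ≡ sum (map sum xss)
sum-concat [] = refl
sum-concat (xs ∷ xss) = trans (sum-++ xs (concat xss)) (cong (sum xs +_) (sum-concat xss))

sum-concatMap : ∀ {X : Set} (f : X → List ℕ) xs → sum (concatMap f xs) ≡ sum (map (sum ∘ f) xs)
sum-concatMap f xs = trans (sum-concat (map f xs)) (cong sum (sym (map-∘ xs)))

sumBelow : ℕ → (ℕ → ℕ) → ℕ
sumBelow zero g = 0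
sumBelow (suc M) g = g 0 + sumBelow M (g ∘ suc)

sum-allFin : ∀ M (g : ℕ → ℕ) → sum (map (g ∘ toℕ) (allFin M)) ≡ sumBelow M g
sum-allFin M g = trans (cong sum (map-tabulate {n = M} id (g ∘ toℕ))) (sum-tabulate M g)
  where
  sum-tabulate : ∀ M (g : ℕ → ℕ) → sum (tabulate {n = M} (g ∘ toℕ)) ≡ sumBelow M g
  sum-tabulate zero g = refl
  sum-tabulate (suc M) g = cong (g 0 +_) (sum-tabulate M (g ∘ suc))

-- window i k v = 1 if i ≤ v < i + k, and 0 otherwise
window : ℕ → ℕ → ℕ → ℕ
window zero zero v = 0
window zero (suc k) zero = 1
window zero (suc k) (suc v) = window zero k v
window (suc i) k zero = 0
window (suc i) k (suc v) = window i k v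

sumBelow-window : ∀ M i k → sumBelow M (window i k) ≤ k
sumBelow-window zero i k = z≤n
sumBelow-window (suc M) zero zero = sumBelow-window M zero zero
sumBelow-window (suc M) zero (suc k) = s≤s (sumBelow-window M zero k)
sumBelow-window (suc M) (suc i) k = sumBelow-window M i k

window-inside : ∀ i k v → i ≤ v → v < i + k → window i k v ≡ 1
window-inside zero (suc k) zero _ _ = refl
window-inside zero (suc k) (suc v) _ (s≤s v<k) = window-inside zero k v z≤n v<k
window-inside (suc i) k (suc v) (s≤s i≤v) (s≤s v<i+k) = window-inside i k v i≤v v<i+k

below-end-of-interval : ∀ i v j → i ≤ v → suc (suc v) ≤ j → v < i + ((suc j ∸ i) ∸ 2)
below-end-of-interval i v j i≤v v+2≤j = begin-strict
  v                      ≡⟨ m+[n∸m]≡n i≤v ⟨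
  i + d                  <⟨ +-monoʳ-< i (∸-monoˡ-≤ 2 width) ⟩
  i + ((suc j ∸ i) ∸ 2) ∎
  where
  open ≤-Reasoning
  d = v ∸ i
  width : 3 + d ≤ suc j ∸ i
  width = begin
    3 + d             ≡⟨ m+n∸m≡n i (3 + d) ⟨
    i + (3 + d) ∸ i   ≡⟨ cong (_∸ i) (+-comm-3 i d) ⟩
    3 + (i + d) ∸ i   ≡⟨ cong (λ w → 3 + w ∸ i) (m+[n∸m]≡n i≤v) ⟩
    3 + v ∸ i         ≤⟨ ∸-monoˡ-≤ i (s≤s v+2≤j) ⟩
    suc j ∸ i         ∎
    where +-comm-3 : ∀ i d → i + (3 + d) ≡ 3 + (i + d)
          +-comm-3 = solve-∀

length-filter-tabulate : ∀ {K L : ℕ} M (g : Fin M → Fin K) (h : Fin M → Fin L)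
  {P : Pred (Fin K) 0ℓ} {Q : Pred (Fin L) 0ℓ} (P? : Decidable P) (Q? : Decidable Q) →
  (∀ k → does (P? (g k)) ≡ does (Q? (h k))) →
  length (filter P? (tabulate g)) ≡ length (filter Q? (tabulate h))
length-filter-tabulate zero g h P? Q? same = refl
length-filter-tabulate (suc M) g h P? Q? same with does (P? (g F.zero)) | does (Q? (h F.zero)) | same F.zero
... | true | true | refl = cong suc (length-filter-tabulate M (g ∘ F.suc) (h ∘ F.suc) P? Q? (same ∘ F.suc))
... | false | false | refl = length-filter-tabulate M (g ∘ F.suc) (h ∘ F.suc) P? Q? (same ∘ F.suc)

-- the list of elements of A has ∣ A ∣ entries (induction on A, where the
-- membership test for suc k in s ∷ A reduces to that of k in A)
∣∣≡length-elems : ∀ {M} (A : Subset M) → ∣ A ∣ ≡ length (elems A)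
∣∣≡length-elems [] = refl
∣∣≡length-elems {suc M} (inside ∷ A) =
  cong suc (trans (∣∣≡length-elems A)
                  (length-filter-tabulate M id F.suc (_∈? A) (_∈? (inside ∷ A)) (λ _ → refl)))
∣∣≡length-elems {suc M} (outside ∷ A) =
  trans (∣∣≡length-elems A) (length-filter-tabulate M id F.suc (_∈? A) (_∈? (outside ∷ A)) (λ _ → refl))

elems-increasing : ∀ {M} (A : Subset M) → AllPairs F._<_ (elems A)
elems-increasing A = AllPairs.filter⁺ (_∈? A) (AllPairs.tabulate⁺-< id)

-- skip a p is the vertex of G that becomes vertex p of G - a
-- (the ℕ-version of Data.Fin.punchIn).
skip : ℕ → ℕ → ℕ
skip zero p = suc p
skip (suc a) zero = zero
skip (suc a) (suc p) = suc (skip a p)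

skip-below : ∀ {a p} → p < a → skip a p ≡ p
skip-below {suc a} {zero} _ = refl
skip-below {suc a} {suc p} (s≤s p<a) = cong suc (skip-below p<a)

skip-above : ∀ {a p} → a ≤ p → skip a p ≡ suc p
skip-above {zero} _ = refl
skip-above {suc a} {suc p} (s≤s a≤p) = cong suc (skip-above a≤p)

-- A graph on the vertices 0, …, N, given by a symmetric adjacency function
-- (its values beyond N are irrelevant).
module Deletions (N : ℕ) (A : ℕ → ℕ → Bool) (symA : ∀ x y → A x y ≡ A y x) where

  SameDeletion : ℕ → ℕ → Set
  SameDeletion a b = ∀ p q → p < N → q < N → A (skip a p) (skip a q) ≡ A (skip b p) (skip b q)

  Outside : ℕ → ℕ → ℕ → Set
  Outside a b z = z < a ⊎ b < z

  -- If G - a = G - b with a < b, then G looks the same from both sides of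
  -- the gap: vertices outside [a, b] see [a, b] uniformly, and inside [a, b]
  -- adjacency is invariant under shifting both ends by one.
  module OneDeletion (a b : ℕ) (a<b : a < b) (b≤N : b ≤ N) (same : SameDeletion a b) where

    -- the vertex p of the common graph sits at u, v in G - b and at u', v' in G - a
    transfer : ∀ {p q u v u' v'} → p < N → q < N →
      skip b p ≡ u → skip b q ≡ v → skip a p ≡ u' → skip a q ≡ v' → A u v ≡ A u' v'
    transfer p<N q<N refl refl refl refl = sym (same _ _ p<N q<N)

    outsideVertex : ∀ z → z ≤ N → Outside a b z →
      Σ ℕ λ p → p < N × skip b p ≡ z × skip a p ≡ z
    outsideVertex z z≤N (inj₁ z<a) =
      z , <-≤-trans (<-trans z<a a<b) b≤N , skip-below (<-trans z<a a<b) , skip-below z<a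
    outsideVertex (suc p) p<N (inj₂ (s≤s b≤p)) =
      p , p<N , skip-above b≤p , skip-above (≤-trans (<⇒≤ a<b) b≤p)

    rowStep : ∀ z y → z ≤ N → Outside a b z → a ≤ y → y < b → A z y ≡ A z (suc y)
    rowStep z y z≤N out a≤y y<b =
      let (p , p<N , bp , ap) = outsideVertex z z≤N out
      in transfer p<N (<-≤-trans y<b b≤N) bp (skip-below y<b) ap (skip-above a≤y)

    diagonalStep : ∀ x y → a ≤ x → x < b → a ≤ y → y < b → A x y ≡ A (suc x) (suc y)
    diagonalStep x y a≤x x<b a≤y y<b =
      transfer (<-≤-trans x<b b≤N) (<-≤-trans y<b b≤N)
        (skip-below x<b) (skip-below y<b) (skip-above a≤x) (skip-above a≤y)

    rowConstant : ∀ z → z ≤ N → Outside a b z → ∀ w → a ≤ w → w ≤ b → A z w ≡ A z a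
    rowConstant z z≤N out w a≤w w≤b with m≤n⇒m<n∨m≡n a≤w
    ... | inj₂ a≡w = cong (A z) (sym a≡w)
    rowConstant z z≤N out (suc w) _ w<b | inj₁ (s≤s a≤w) =
      trans (sym (rowStep z w z≤N out a≤w w<b)) (rowConstant z z≤N out w a≤w (<⇒≤ w<b))

    slide : ∀ k x y → a ≤ x → a ≤ y → x + k ≤ b → y + k ≤ b → A x y ≡ A (x + k) (y + k)
    slide zero x y _ _ _ _ = sym (cong₂ A (+-identityʳ x) (+-identityʳ y))
    slide (suc k) x y a≤x a≤y x+k≤b y+k≤b = begin
      A x y                     ≡⟨ diagonalStep x y a≤x (below x x+k≤b) a≤y (below y y+k≤b) ⟩
      A (suc x) (suc y)         ≡⟨ slide k (suc x) (suc y) (m≤n⇒m≤1+n a≤x) (m≤n⇒m≤1+n a≤y)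
                                     (shifted x x+k≤b) (shifted y y+k≤b) ⟩
      A (suc x + k) (suc y + k) ≡⟨ cong₂ A (+-suc x k) (+-suc y k) ⟨
      A (x + suc k) (y + suc k) ∎
      where
      open ≡-Reasoning
      shifted : ∀ v → v + suc k ≤ b → suc v + k ≤ b
      shifted v = ≤-trans (≤-reflexive (sym (+-suc v k)))
      below : ∀ v → v + suc k ≤ b → v < b
      below v = <-≤-trans (m<m+n v (s≤s z≤n))

  -- If G - a = G - b = G - c with a < b < c, then [a, c] is homogeneous:
  -- all pairs inside have the same adjacency β and outside vertices see
  -- [a, c] uniformly, so any two vertices of [a, c] are twins.
  module TwoDeletions (a b c : ℕ) (a<b : a < b) (b<c : b < c) (c≤N : c ≤ N)
                      (sameAB : SameDeletion a b) (sameBC : SameDeletion b c) where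

    private
      b≤N : b ≤ N
      b≤N = ≤-trans (<⇒≤ b<c) c≤N
      a≤N : a ≤ N
      a≤N = ≤-trans (<⇒≤ a<b) b≤N
      module L = OneDeletion a b a<b b≤N sameAB
      module R = OneDeletion b c b<c c≤N sameBC

    β : Bool
    β = A a b

    -- every vertex of [a, c] other than b is joined to b exactly when a is,
    -- read off from rows of vertices outside one of the two halves
    leftToMiddle : ∀ x → a ≤ x → x < b → A x b ≡ β
    leftToMiddle x a≤x x<b = begin
      A x b ≡⟨ R.rowConstant x (≤-trans (<⇒≤ x<b) b≤N) (inj₁ x<b) c (<⇒≤ b<c) ≤-refl ⟨
      A x c ≡⟨ symA x c ⟩
      A c x ≡⟨ L.rowConstant c c≤N (inj₂ b<c) x a≤x (<⇒≤ x<b) ⟩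
      A c a ≡⟨ symA c a ⟩
      A a c ≡⟨ R.rowConstant a a≤N (inj₁ a<b) c (<⇒≤ b<c) ≤-refl ⟩
      A a b ∎
      where open ≡-Reasoning

    rightToMiddle : ∀ y → b < y → y ≤ c → A y b ≡ β
    rightToMiddle y b<y y≤c = begin
      A y b ≡⟨ L.rowConstant y (≤-trans y≤c c≤N) (inj₂ b<y) b (<⇒≤ a<b) ≤-refl ⟩
      A y a ≡⟨ symA y a ⟩
      A a y ≡⟨ R.rowConstant a a≤N (inj₁ a<b) y (<⇒≤ b<y) y≤c ⟩
      A a b ∎
      where open ≡-Reasoning

    -- a pair straddling b: the row of x is constant on [b, c]
    acrossMiddle : ∀ x y → a ≤ x → x < b → b < y → y ≤ c → A x y ≡ β
    acrossMiddle x y a≤x x<b b<y y≤c =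
      trans (R.rowConstant x (≤-trans (<⇒≤ x<b) b≤N) (inj₁ x<b) y (<⇒≤ b<y) y≤c) (leftToMiddle x a≤x x<b)

    -- a pair x < y ≤ b slides up to the pair (x + k, b)
    leftPair : ∀ k x y → a ≤ x → x < y → y + k ≡ b → A x y ≡ β
    leftPair k x y a≤x x<y y+k≡b = begin
      A x y             ≡⟨ L.slide k x y a≤x a≤y (<⇒≤ x+k<b) (≤-reflexive y+k≡b) ⟩
      A (x + k) (y + k) ≡⟨ cong (A (x + k)) y+k≡b ⟩
      A (x + k) b       ≡⟨ leftToMiddle (x + k) (≤-trans a≤x (m≤m+n x k)) x+k<b ⟩
      β ∎
      where
      open ≡-Reasoning
      a≤y = ≤-trans a≤x (<⇒≤ x<y)
      x+k<b : x + k < b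
      x+k<b = <-≤-trans (+-monoˡ-< k x<y) (≤-reflexive y+k≡b)

    -- a pair (b + k, y + k) slides down to the pair (b, y)
    rightPair : ∀ k y → b < y → y + k ≤ c → A (b + k) (y + k) ≡ β
    rightPair k y b<y y+k≤c = begin
      A (b + k) (y + k) ≡⟨ R.slide k b y ≤-refl (<⇒≤ b<y) b+k≤c y+k≤c ⟨
      A b y             ≡⟨ symA b y ⟩
      A y b             ≡⟨ rightToMiddle y b<y (≤-trans (m≤m+n y k) y+k≤c) ⟩
      β ∎
      where
      open ≡-Reasoning
      b+k≤c = ≤-trans (+-monoˡ-≤ k (<⇒≤ b<y)) y+k≤c

    orderedPair : ∀ u v → a ≤ u → u < v → v ≤ c → A u v ≡ β
    orderedPair u v a≤u u<v v≤c with v ≤? b | b ≤? u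
    ... | yes v≤b | _ = leftPair (b ∸ v) u v a≤u u<v (m+[n∸m]≡n v≤b)
    ... | no _ | yes b≤u =
      subst₂ (λ s t → A s t ≡ β) (m+[n∸m]≡n b≤u) (m∸n+n≡m k≤v)
             (rightPair k (v ∸ k) b<v∸k (≤-trans (≤-reflexive (m∸n+n≡m k≤v)) v≤c))
      where
      k = u ∸ b
      k≤v : k ≤ v
      k≤v = ≤-trans (m∸n≤m u b) (<⇒≤ u<v)
      b<v∸k : b < v ∸ k
      b<v∸k = +-cancelʳ-< k b (v ∸ k)
                (subst₂ _<_ (sym (m+[n∸m]≡n b≤u)) (sym (m∸n+n≡m k≤v)) u<v)
    ... | no v≰b | no u≱b = acrossMiddle u v a≤u (≰⇒> u≱b) (≰⇒> v≰b) v≤c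

    distinctPair : ∀ u v → a ≤ u → u ≤ c → a ≤ v → v ≤ c → ¬ u ≡ v → A u v ≡ β
    distinctPair u v a≤u u≤c a≤v v≤c u≢v with <-cmp u v
    ... | tri< u<v _ _ = orderedPair u v a≤u u<v v≤c
    ... | tri≈ _ u≡v _ = ⊥-elim (u≢v u≡v)
    ... | tri> _ _ v<u = trans (symA u v) (orderedPair v u a≤v v<u u≤c)

    outsideRowConstant : ∀ z → z ≤ N → Outside a c z → ∀ w → a ≤ w → w ≤ c → A z w ≡ A z a
    outsideRowConstant z z≤N out w a≤w w≤c with w ≤? b
    ... | yes w≤b = L.rowConstant z z≤N outsideLeft w a≤w w≤b
      where outsideLeft = Sum.map₂ (<-trans b<c) out
    ... | no w≰b = trans (R.rowConstant z z≤N outsideRight w (<⇒≤ (≰⇒> w≰b)) w≤c)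
                         (L.rowConstant z z≤N outsideLeft b (<⇒≤ a<b) ≤-refl)
      where outsideLeft = Sum.map₂ (<-trans b<c) out
            outsideRight = Sum.map₁ (λ z<a → <-trans z<a a<b) out

    seenUniformly : ∀ x y z → a ≤ x → x ≤ c → a ≤ y → y ≤ c → z ≤ N → Outside a c z →
      A x z ≡ A y z
    seenUniformly x y z a≤x x≤c a≤y y≤c z≤N out = begin
      A x z ≡⟨ symA x z ⟩
      A z x ≡⟨ outsideRowConstant z z≤N out x a≤x x≤c ⟩
      A z a ≡⟨ outsideRowConstant z z≤N out y a≤y y≤c ⟨
      A z y ≡⟨ symA z y ⟩
      A y z ∎
      where open ≡-Reasoning

    twins : ∀ x y z → a ≤ x → x ≤ c → a ≤ y → y ≤ c → z ≤ N →
            ¬ z ≡ x → ¬ z ≡ y → A x z ≡ A y z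
    twins x y z a≤x x≤c a≤y y≤c z≤N z≢x z≢y with a ≤? z | z ≤? c
    ... | yes a≤z | yes z≤c =
      trans (distinctPair x z a≤x x≤c a≤z z≤c (z≢x ∘ sym))
            (sym (distinctPair y z a≤y y≤c a≤z z≤c (z≢y ∘ sym)))
    ... | no a≰z | _ = seenUniformly x y z a≤x x≤c a≤y y≤c z≤N (inj₁ (≰⇒> a≰z))
    ... | yes _ | no z≰c = seenUniformly x y z a≤x x≤c a≤y y≤c z≤N (inj₂ (≰⇒> z≰c))

≤ᵇ-true⇒≤ : ∀ {m n} → (m ≤ᵇ n) ≡ true → m ≤ n
≤ᵇ-true⇒≤ {m} {n} e = ≤ᵇ⇒≤ m n (subst T (sym e) tt)

≤⇒≤ᵇ-true : ∀ {m n} → m ≤ n → (m ≤ᵇ n) ≡ true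
≤⇒≤ᵇ-true {m} {n} m≤n = dec-true (m ≤? n) m≤n

∧-true : ∀ {x y} → x ∧ y ≡ true → x ≡ true × y ≡ true
∧-true {true} {true} _ = refl , refl

all-true : ∀ {X : Set} (p : X → Bool) (xs : List X) → (∀ x → p x ≡ true) → all p xs ≡ true
all-true p [] h = refl
all-true p (x ∷ xs) h rewrite h x = all-true p xs h

all-false : ∀ {X : Set} (p : X → Bool) (xs : List X) → all p xs ≡ false → Σ X (λ x → p x ≡ false)
all-false p (x ∷ xs) e with p x in px
... | false = x , px
... | true = all-false p xs e

-- the Data.Vec lemma removeAt-punchOut, restated through punchIn
lookup-removeAt : ∀ {X : Set} {n} (xs : Vec X (suc n)) i k →
  lookup (removeAt xs i) k ≡ lookup xs (punchIn i k)
lookup-removeAt xs i k = begin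
  lookup (removeAt xs i) k                                 ≡⟨ cong (lookup (removeAt xs i)) (punchOut-punchIn i) ⟨
  lookup (removeAt xs i) (punchOut (punchInᵢ≢i i k ∘ sym)) ≡⟨ removeAt-punchOut xs (punchInᵢ≢i i k ∘ sym) ⟩
  lookup xs (punchIn i k) ∎
  where open ≡-Reasoning

toℕ-punchIn : ∀ {n} (i : Fin (suc n)) (j : Fin n) → toℕ (punchIn i j) ≡ skip (toℕ i) (toℕ j)
toℕ-punchIn F.zero j = refl
toℕ-punchIn (F.suc i) F.zero = refl
toℕ-punchIn (F.suc i) (F.suc j) = cong suc (toℕ-punchIn i j)

adj-delete : ∀ {N} (G : Mat (suc N)) v k l → adj (delete G v) k l ≡ adj G (punchIn v k) (punchIn v l)
adj-delete G v k l = begin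
  lookup (lookup (V.map (λ row → removeAt row v) (removeAt G v)) k) l
    ≡⟨ cong (λ row → lookup row l) (lookup-map k (λ row → removeAt row v) (removeAt G v)) ⟩
  lookup (removeAt (lookup (removeAt G v) k) v) l
    ≡⟨ lookup-removeAt (lookup (removeAt G v) k) v l ⟩
  lookup (lookup (removeAt G v) k) (punchIn v l)
    ≡⟨ cong (λ row → lookup row (punchIn v l)) (lookup-removeAt G v k) ⟩
  lookup (lookup G (punchIn v k)) (punchIn v l) ∎
  where open ≡-Reasoning

==-refl : ∀ {n} (x : Fin n) → (x == x) ≡ true
==-refl x = trans (isYes≗does (x ≟ x)) (dec-true (x ≟ x) refl)

twin-intro : ∀ {n} (G : Mat n) x y →
  (∀ z → (adj G x z ∧ not (z == y)) ≡ (adj G y z ∧ not (z == x))) → twin G x y ≡ true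
twin-intro {n} G x y rows =
  all-true _ (allFin n) (λ z → trans (isYes≗does (_ ≟ᵇ _)) (dec-true (_ ≟ᵇ _) (rows z)))

-- The fuel for growing an interval [i, j] inside [0, N] shrinks as the
-- interval strictly grows (i' + j < i + j' for [i', j'] ⊇ [i, j]).
fuel-decreases : ∀ N f i j i' j' → suc N + i ≤ suc f + j → i' + j < i + j' → suc N + i' ≤ f + j'
fuel-decreases N f i j i' j' fuel grows = +-cancelʳ-≤ (suc j) (suc N + i') (f + j') (begin
  (suc N + i') + suc j ≡⟨ regroup₁ N i' j ⟩
  suc N + suc (i' + j) ≤⟨ +-monoʳ-≤ (suc N) grows ⟩
  suc N + (i + j')     ≡⟨ +-assoc (suc N) i j' ⟨
  (suc N + i) + j'     ≤⟨ +-monoˡ-≤ j' fuel ⟩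
  (suc f + j) + j'     ≡⟨ regroup₂ f j j' ⟩
  (f + j') + suc j ∎)
  where
  open ≤-Reasoning
  regroup₁ : ∀ N i j → (suc N + i) + suc j ≡ suc N + suc (i + j)
  regroup₁ = solve-∀
  regroup₂ : ∀ f j k → (suc f + j) + k ≡ (f + k) + suc j
  regroup₂ = solve-∀

module OrderedGraph (N : ℕ) (G : Mat (suc N)) (isG : IsGraph G) where

  -- G read as an adjacency function on ℕ (values beyond N are irrelevant)
  vertex : ℕ → Fin (suc N)
  vertex x with x <? suc N
  ... | yes x<n = fromℕ< x<n
  ... | no _ = F.zero

  vertex-toℕ : ∀ i → vertex (toℕ i) ≡ i
  vertex-toℕ i with toℕ i <? suc N
  ... | yes i<n = fromℕ<-toℕ i i<n
  ... | no i≮n = ⊥-elim (i≮n (toℕ<n i))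

  A : ℕ → ℕ → Bool
  A x y = adj G (vertex x) (vertex y)

  adj≡A : ∀ i j → adj G i j ≡ A (toℕ i) (toℕ j)
  adj≡A i j rewrite vertex-toℕ i | vertex-toℕ j = refl

  open Deletions N A (λ x y → proj₁ isG (vertex x) (vertex y))

  sameDeletion : ∀ a b → delete G a ≡ delete G b → SameDeletion (toℕ a) (toℕ b)
  sameDeletion a b Ga≡Gb p q p<N q<N = begin
    A (skip (toℕ a) p) (skip (toℕ a) q) ≡⟨ positions a ⟨
    adj (delete G a) k l                ≡⟨ cong (λ H → adj H k l) Ga≡Gb ⟩
    adj (delete G b) k l                ≡⟨ positions b ⟩
    A (skip (toℕ b) p) (skip (toℕ b) q) ∎
    where
    open ≡-Reasoning
    k = fromℕ< p<N
    l = fromℕ< q<N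
    positions : ∀ v → adj (delete G v) k l ≡ A (skip (toℕ v) p) (skip (toℕ v) q)
    positions v = begin
      adj (delete G v) k l                        ≡⟨ adj-delete G v k l ⟩
      adj G (punchIn v k) (punchIn v l)           ≡⟨ adj≡A _ _ ⟩
      A (toℕ (punchIn v k)) (toℕ (punchIn v l))   ≡⟨ cong₂ A (toℕ-punchIn v k) (toℕ-punchIn v l) ⟩
      A (skip (toℕ v) (toℕ k)) (skip (toℕ v) (toℕ l))
        ≡⟨ cong₂ (λ s t → A (skip (toℕ v) s) (skip (toℕ v) t)) (toℕ-fromℕ< p<N) (toℕ-fromℕ< q<N) ⟩
      A (skip (toℕ v) p) (skip (toℕ v) q) ∎

  homogeneous : ∀ a b c → toℕ a < toℕ b → toℕ b < toℕ c →
    delete G a ≡ delete G b → delete G b ≡ delete G c → homog G a c ≡ true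
  homogeneous a b c a<b b<c Ga≡Gb Gb≡Gc =
    all-true _ (allFin (suc N)) λ x → all-true _ (allFin (suc N)) λ y → pair x y
    where
    module Interval = TwoDeletions (toℕ a) (toℕ b) (toℕ c) a<b b<c (≤-pred (toℕ<n c))
                            (sameDeletion a b Ga≡Gb) (sameDeletion b c Gb≡Gc)
    -- two vertices of [a, c] have the same row off {x, y} (at z = x or
    -- z = y both sides vanish, as G has no loops)
    rows : ∀ x y → toℕ a ≤ toℕ x → toℕ x ≤ toℕ c → toℕ a ≤ toℕ y → toℕ y ≤ toℕ c →
      ∀ z → (adj G x z ∧ not (z == y)) ≡ (adj G y z ∧ not (z == x))
    rows x y a≤x x≤c a≤y y≤c z with z ≟ y | z ≟ x
    ... | yes refl | _ = trans (∧-zeroʳ _) (cong (_∧ _) (sym (proj₂ isG z)))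
    ... | no _ | yes refl = trans (cong (_∧ _) (proj₂ isG z)) (sym (∧-zeroʳ _))
    ... | no z≢y | no z≢x = begin
      adj G x z ∧ true  ≡⟨ ∧-identityʳ _ ⟩
      adj G x z         ≡⟨ adj≡A x z ⟩
      A (toℕ x) (toℕ z) ≡⟨ Interval.twins (toℕ x) (toℕ y) (toℕ z) a≤x x≤c a≤y y≤c (≤-pred (toℕ<n z))
                             (z≢x ∘ toℕ-injective) (z≢y ∘ toℕ-injective) ⟩
      A (toℕ y) (toℕ z) ≡⟨ adj≡A y z ⟨
      adj G y z         ≡⟨ ∧-identityʳ _ ⟨
      adj G y z ∧ true  ∎
      where open ≡-Reasoning
    pair : ∀ x y → (not (inI a c x ∧ inI a c y) ∨ twin G x y) ≡ true
    pair x y with inI a c x in x∈ | inI a c y in y∈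
    ... | false | _ = refl
    ... | true | false = refl
    ... | true | true =
      let (a≤x , x≤c) = ∧-true x∈ ; (a≤y , y≤c) = ∧-true y∈ in
      twin-intro G x y (rows x y (≤ᵇ-true⇒≤ a≤x) (≤ᵇ-true⇒≤ x≤c) (≤ᵇ-true⇒≤ a≤y) (≤ᵇ-true⇒≤ y≤c))

  maximal : Fin (suc N) → Fin (suc N) → Bool
  maximal i j = all (λ i' → all (λ j' →
        not ((toℕ i' ≤ᵇ toℕ i) ∧ (toℕ j ≤ᵇ toℕ j') ∧ homog G i' j')
        ∨ ((i' == i) ∧ (j' == j))) (allFin (suc N))) (allFin (suc N))

  enlarge : ∀ i j → (toℕ i ≤ᵇ toℕ j) ≡ true → homog G i j ≡ true → isBlock G i j ≡ false →
    Σ (Fin (suc N)) λ i' → Σ (Fin (suc N)) λ j' →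
      toℕ i' ≤ toℕ i × toℕ j ≤ toℕ j' × homog G i' j' ≡ true × toℕ i' + toℕ j < toℕ i + toℕ j'
  enlarge i j i≤j hom notBlock =
    let (i' , ¬maxᵢ) = all-false _ (allFin (suc N)) (notMaximal i≤j hom notBlock)
        (j' , ¬maxᵢⱼ) = all-false _ (allFin (suc N)) ¬maxᵢ
        (contains , different) = violation ¬maxᵢⱼ
        (i'≤i , j≤j'∧hom) = ∧-true contains
        (j≤j' , hom') = ∧-true j≤j'∧hom
    in i' , j' , ≤ᵇ-true⇒≤ i'≤i , ≤ᵇ-true⇒≤ j≤j' , hom' ,
       strictly (≤ᵇ-true⇒≤ i'≤i) (≤ᵇ-true⇒≤ j≤j') different
    where
    notMaximal : ∀ {p q} → p ≡ true → q ≡ true → p ∧ (q ∧ maximal i j) ≡ false → maximal i j ≡ false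
    notMaximal refl refl e = e
    violation : ∀ {p q} → (not p ∨ q) ≡ false → p ≡ true × q ≡ false
    violation {true} {false} _ = refl , refl
    strictly : ∀ {i' j'} → toℕ i' ≤ toℕ i → toℕ j ≤ toℕ j' → ((i' == i) ∧ (j' == j)) ≡ false →
      toℕ i' + toℕ j < toℕ i + toℕ j'
    strictly {i'} {j'} i'≤i j≤j' different with m≤n⇒m<n∨m≡n i'≤i | m≤n⇒m<n∨m≡n j≤j'
    ... | inj₁ i'<i | _ = +-mono-<-≤ i'<i j≤j'
    ... | inj₂ _ | inj₁ j<j' = +-mono-≤-< i'≤i j<j'
    ... | inj₂ i'≡i | inj₂ j≡j' with toℕ-injective i'≡i | toℕ-injective (sym j≡j')
    ...   | refl | refl with trans (sym different) (cong₂ _∧_ (==-refl i) (==-refl j))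
    ...     | ()

  -- every homogeneous interval [i, j] lies inside a homogeneous block
  -- (grow it until it is maximal; the fuel bounds the number of steps)
  block-containing : ∀ i j → toℕ i ≤ toℕ j → homog G i j ≡ true →
    Σ (Fin (suc N)) λ i' → Σ (Fin (suc N)) λ j' →
      isBlock G i' j' ≡ true × toℕ i' ≤ toℕ i × toℕ j ≤ toℕ j'
  block-containing i j i≤j hom = grow (suc N + toℕ i) i j i≤j hom (m≤m+n _ _)
    where
    grow : ∀ fuel i j → toℕ i ≤ toℕ j → homog G i j ≡ true → suc N + toℕ i ≤ fuel + toℕ j →
      Σ (Fin (suc N)) λ i' → Σ (Fin (suc N)) λ j' →
        isBlock G i' j' ≡ true × toℕ i' ≤ toℕ i × toℕ j ≤ toℕ j'
    grow zero i j _ _ fuel =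
      ⊥-elim (<-irrefl refl (≤-trans (≤-trans (m≤m+n (suc N) (toℕ i)) fuel) (≤-pred (toℕ<n j))))
    grow (suc f) i j i≤j hom fuel with isBlock G i j in block?
    ... | true = i , j , block? , ≤-refl , ≤-refl
    ... | false =
      let (i' , j' , i'≤i , j≤j' , hom' , grows) = enlarge i j (≤⇒≤ᵇ-true i≤j) hom block?
          (i'' , j'' , block , i''≤i' , j'≤j'') =
            grow f i' j' (≤-trans i'≤i (≤-trans i≤j j≤j')) hom'
                 (fuel-decreases N f (toℕ i) (toℕ j) (toℕ i') (toℕ j') fuel grows)
      in i'' , j'' , block , ≤-trans i''≤i' i'≤i , ≤-trans j≤j' j'≤j''

module Bound (N : ℕ) (G : Mat (suc N)) (isG : IsGraph G) where
  open OrderedGraph N G isG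
  open Multiplicities (Mat-≟ {N})

  vertices : List (Fin (suc N))
  vertices = allFin (suc N)

  deepIn : Fin (suc N) → Fin (suc N) → Fin (suc N) → ℕ
  deepIn x i j = if isBlock G i j ∧ ((toℕ i ≤ᵇ toℕ x) ∧ (suc (suc (toℕ x)) ≤ᵇ toℕ j)) then 1 else 0

  deepBlocks : Fin (suc N) → ℕ
  deepBlocks x = sum (map (λ i → sum (map (deepIn x i) vertices)) vertices)

  -- if x < b < c and G - x = G - b = G - c then [x, c] is homogeneous, so it
  -- lies in a block [i, j] with i ≤ x and x + 2 ≤ c ≤ j
  atLeastTwo≤deepBlocks : ∀ x zs → All (x F.<_) zs → AllPairs F._<_ zs →
    atLeastTwo (occurrences (delete G x) (map (delete G) zs)) ≤ deepBlocks x
  atLeastTwo≤deepBlocks x zs x<zs sorted with occurrences (delete G x) (map (delete G) zs) in occ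
  ... | zero = z≤n
  ... | suc zero = z≤n
  ... | suc (suc _) =
    let (b , c , b∈ , c∈ , b<c , Gx≡Gb , Gx≡Gc) =
          occurs-twice-in-map (delete G) (delete G x) zs sorted (≤-trans (s≤s (s≤s z≤n)) (≤-reflexive (sym occ)))
        x<b = All-lookup x<zs b∈
        (i , j , block , i≤x , c≤j) =
          block-containing x c (<⇒≤ (<-trans x<b b<c)) (homogeneous x b c x<b b<c Gx≡Gb (trans (sym Gx≡Gb) Gx≡Gc))
        deep : deepIn x i j ≡ 1
        deep = cong (λ t → if t then 1 else 0)
                 (trans (cong₂ (λ s t → s ∧ (t ∧ (suc (suc (toℕ x)) ≤ᵇ toℕ j))) block (≤⇒≤ᵇ-true i≤x))
                        (≤⇒≤ᵇ-true (≤-trans (≤-trans (s≤s x<b) b<c) c≤j)))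
    in begin
      1                                         ≡⟨ deep ⟨
      deepIn x i j                              ≤⟨ term≤sum (deepIn x i) vertices (∈-allFin j) ⟩
      sum (map (deepIn x i) vertices)   ≤⟨ term≤sum (λ i → sum (map (deepIn x i) vertices)) vertices (∈-allFin i) ⟩
      deepBlocks x ∎
    where open ≤-Reasoning

  repeats≤deepBlocks : ∀ xs → AllPairs F._<_ xs → repeats (map (delete G) xs) ≤ sum (map deepBlocks xs)
  repeats≤deepBlocks [] _ = z≤n
  repeats≤deepBlocks (x ∷ xs) (x<xs ∷ sorted) =
    +-mono-≤ (atLeastTwo≤deepBlocks x xs x<xs sorted) (repeats≤deepBlocks xs sorted)

  excessTerm : Fin (suc N) → Fin (suc N) → ℕ
  excessTerm i j = if isBlock G i j then (suc (toℕ j) ∸ toℕ i) ∸ 2 else 0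

  deepIn≤excessTerm : ∀ i j → sum (map (λ x → deepIn x i j) vertices) ≤ excessTerm i j
  deepIn≤excessTerm i j with isBlock G i j
  ... | false = ≤-reflexive (sum-zero vertices)
  ... | true = begin
      sum (map (λ x → if (toℕ i ≤ᵇ toℕ x) ∧ (suc (suc (toℕ x)) ≤ᵇ toℕ j) then 1 else 0) vertices)
        ≤⟨ sum-mono _ (window (toℕ i) width ∘ toℕ) vertices inWindow ⟩
      sum (map (window (toℕ i) width ∘ toℕ) vertices) ≡⟨ sum-allFin (suc N) (window (toℕ i) width) ⟩
      sumBelow (suc N) (window (toℕ i) width)         ≤⟨ sumBelow-window (suc N) (toℕ i) width ⟩
      width                                           ∎
    where
    open ≤-Reasoning
    width = (suc (toℕ j) ∸ toℕ i) ∸ 2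
    inWindow : ∀ x → (if (toℕ i ≤ᵇ toℕ x) ∧ (suc (suc (toℕ x)) ≤ᵇ toℕ j) then 1 else 0)
                     ≤ window (toℕ i) width (toℕ x)
    inWindow x with (toℕ i ≤ᵇ toℕ x) ∧ (suc (suc (toℕ x)) ≤ᵇ toℕ j) in deep
    ... | false = z≤n
    ... | true = let (i≤x , x+2≤j) = ∧-true deep in
      ≤-reflexive (sym (window-inside (toℕ i) width (toℕ x) (≤ᵇ-true⇒≤ i≤x)
        (below-end-of-interval (toℕ i) (toℕ x) (toℕ j) (≤ᵇ-true⇒≤ i≤x) (≤ᵇ-true⇒≤ x+2≤j))))

  -- exchanging the order of summation, each block is charged once
  deepBlocks≤excess : sum (map deepBlocks vertices) ≤ excess G
  deepBlocks≤excess = begin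
    sum (map deepBlocks vertices)
      ≡⟨ sum-swap (λ x i → sum (map (deepIn x i) vertices)) vertices vertices ⟩
    sum (map (λ i → sum (map (λ x → sum (map (deepIn x i) vertices)) vertices)) vertices)
      ≡⟨ cong sum (map-cong (λ i → sum-swap (λ x j → deepIn x i j) vertices vertices) vertices) ⟩
    sum (map (λ i → sum (map (λ j → sum (map (λ x → deepIn x i j) vertices)) vertices)) vertices)
      ≤⟨ sum-mono _ _ vertices (λ i → sum-mono _ _ vertices (deepIn≤excessTerm i)) ⟩
    sum (map (λ i → sum (map (excessTerm i) vertices)) vertices)
      ≡⟨ sum-concatMap (λ i → map (excessTerm i) vertices) vertices ⟨
    excess G ∎
    where open ≤-Reasoning

lemma5p5 : ∀ (n : ℕ) (G : Mat n) → IsGraph G → (A : Subset n) →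
    ∣ A ∣ ≤ 2 * length (boundary G A) + excess G
lemma5p5 zero G _ [] = z≤n
lemma5p5 (suc N) G isG A = begin
  ∣ A ∣                                ≡⟨ ∣∣≡length-elems A ⟩
  length xs                            ≡⟨ length-map (delete G) xs ⟨
  length Gxs                           ≤⟨ length≤2*distinct+repeats Gxs ⟩
  2 * ∂ + repeats Gxs                  ≤⟨ +-monoʳ-≤ (2 * ∂) (repeats≤deepBlocks xs (elems-increasing A)) ⟩
  2 * ∂ + sum (map deepBlocks xs)       ≤⟨ +-monoʳ-≤ (2 * ∂) (sum-filter (_∈? A) deepBlocks vertices) ⟩
  2 * ∂ + sum (map deepBlocks vertices) ≤⟨ +-monoʳ-≤ (2 * ∂) deepBlocks≤excess ⟩
  2 * ∂ + excess G                      ∎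
  where
  open ≤-Reasoning
  open Bound N G isG
  open Multiplicities (Mat-≟ {N})
  xs = elems A
  Gxs = map (delete G) xs
  ∂ = length (boundary G A)
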